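{- Let $p$ be a prime, let $\delta\in\mathbb{Z}$ satisfy $\delta^2+\delta+1\equiv 0\pmod p$, and let $u,v$ be integers with $u\equiv 0\pmod p$ and $v\equiv\delta\pmod p$. Then the sequences $(\alpha_i)_{i\ge1}$, $(\beta_i)_{i\ge 1}$ defined below satisfy, for all $k\ge 0$ (and all $i\ge1$ for the first line): $\alpha_i\equiv 0\pmod p$; $\beta_1\equiv 1$, $\beta_2\equiv-\delta$, $\beta_{3k+3}\equiv\delta$, $\beta_{3k+4}+\beta_{3k+5}\equiv-\delta\pmod p$; $\beta_{9k+1}\equiv\beta_{3k+1}$, $\beta_{9k+4}\equiv\delta^{ -1}$, $\beta_{9k+7}\equiv 1\pmod p$.
   Context: Given $u,v$, define rational numbers $\alpha_i,\beta_i$ ($i\ge 1$) by $\alpha_1=-u$, $\alpha_2=\frac{u(2v-1-u^2)}{v-u^2}$, $\alpha_3=\frac{ -u(v-1)}{v-u^2}$, $\beta_1=1$, $\beta_2=u^2-v$, $\beta_3=\frac{u^2+u^4+v^3-3u^2v}{(v-u^2)^2}$, and for every $k\ge 0$: $\alpha_{3k+4}=-u$, $\beta_{3k+4}=\frac{\beta_{k+2}}{\beta_{3k+3}\beta_{3k+2}}$, $\beta_{3k+5}=u^2-v-\beta_{3k+4}$, $\alpha_{3k+5}=u-\frac{\alpha_{k+2}+uv-\alpha_{3k+2}\beta_{3k+4}}{\beta_{3k+5}}$, $\alpha_{3k+6}=u-\alpha_{3k+5}$, $\beta_{3k+6}=v-\alpha_{3k+5}\alpha_{3k+6}$. Congruences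 modulo $p$ between rational numbers are understood in the local ring $\mathbb{Z}_{(p)}$ of rationals with denominator prime to $p$; asserting such a congruence for $\alpha_i$ or $\beta_i$ includes that it is well defined (no division by zero) and lies in $\mathbb{Z}_{(p)}$. $\delta^{ -1}$ denotes the inverse of $\delta$ modulo $p$. -}

module Defs where

open import Data.Nat as ℕ using (ℕ; zero; suc)
open import Data.Nat.Divisibility using (_∣_)
open import Data.Nat.DivMod using (_/_; _%_)
open import Data.Integer as ℤ using (ℤ)
open import Data.Integer.Divisibility as ℤD using ()
open import Data.Rational as ℚ using (ℚ; ↥_; ↧ₙ_; 0ℚ; 1ℚ; _÷_; ≢-nonZero)
open import Data.Rational.Properties using (_≟_)
open import Data.Maybe using (Maybe; just; nothing)
open import Data.Product using (Σ; _×_; _,_; proj₁; proj₂)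
open import Relation.Binary.PropositionalEquality using (_≡_)
open import Relation.Nullary using (¬_; yes; no)

-- Partial rational arithmetic: `nothing` records an (earlier) division by zero.
infixl 6 _+?_ _-?_
infixl 7 _*?_ _/?_

_+?_ : Maybe ℚ → Maybe ℚ → Maybe ℚ
just x +? just y = just (x ℚ.+ y)
_      +? _      = nothing

_-?_ : Maybe ℚ → Maybe ℚ → Maybe ℚ
just x -? just y = just (x ℚ.- y)
_      -? _      = nothing

_*?_ : Maybe ℚ → Maybe ℚ → Maybe ℚ
just x *? just y = just (x ℚ.* y)
_      *? _      = nothing

_/?_ : Maybe ℚ → Maybe ℚ → Maybe ℚ
just x /? just y with y ≟ 0ℚ
... | yes _   = nothing
... | no y≢0  = just (_÷_ x y {{≢-nonZero y≢0}})
_      /? _      = nothing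

ι : ℤ → Maybe ℚ
ι z = just (z ℚ./ 1)

-- seqAux u v fuel i = (α_i , β_i), correct whenever fuel ≥ i ≥ 1.
-- Index 0 is unused (value nothing).
seqAux : ℤ → ℤ → ℕ → ℕ → Maybe ℚ × Maybe ℚ
seqAux u v zero _ = nothing , nothing
seqAux u v (suc f) 0 = nothing , nothing
seqAux u v (suc f) 1 = ι (ℤ.- u) , ι (ℤ.+ 1)
seqAux u v (suc f) 2 =
  (ι u *? (ι (ℤ.+ 2) *? ι v -? ι (ℤ.+ 1) -? ι u *? ι u)) /? (ι v -? ι u *? ι u)
  , (ι u *? ι u -? ι v)
seqAux u v (suc f) 3 =
  (ι (ℤ.- u) *? (ι v -? ι (ℤ.+ 1))) /? (ι v -? ι u *? ι u)
  , (ι u *? ι u +? ι u *? ι u *? ι u *? ι u +? ι v *? ι v *? ι v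
       -? ι (ℤ.+ 3) *? ι u *? ι u *? ι v)
    /? ((ι v -? ι u *? ι u) *? (ι v -? ι u *? ι u))
seqAux u v (suc f) (suc (suc (suc (suc j)))) = step (j % 3)
  where
  k = j / 3
  α : ℕ → Maybe ℚ
  α i = proj₁ (seqAux u v f i)
  β : ℕ → Maybe ℚ
  β i = proj₂ (seqAux u v f i)
  β4 = β (k ℕ.+ 2) /? (β (3 ℕ.* k ℕ.+ 3) *? β (3 ℕ.* k ℕ.+ 2))
  β5 = ι u *? ι u -? ι v -? β4
  α5 = ι u -? (α (k ℕ.+ 2) +? ι u *? ι v -? α (3 ℕ.* k ℕ.+ 2) *? β4) /? β5
  α6 = ι u -? α5
  step : ℕ → Maybe ℚ × Maybe ℚ
  step 0 = ι (ℤ.- u) , β4                      -- i = 3k+4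
  step 1 = α5 , β5                             -- i = 3k+5
  step 2 = α6 , (ι v -? α5 *? α6)              -- i = 3k+6
  step _ = nothing , nothing

α : ℤ → ℤ → ℕ → Maybe ℚ
α u v i = proj₁ (seqAux u v i i)

β : ℤ → ℤ → ℕ → Maybe ℚ
β u v i = proj₂ (seqAux u v i i)

InZp : ℕ → ℚ → Set
InZp p x = ¬ (p ∣ (↧ₙ x))

infix 4 _≡_[mod_]
_≡_[mod_] : Maybe ℚ → Maybe ℚ → ℕ → Set
mx ≡ my [mod p ] =
  Σ ℚ λ x → Σ ℚ λ y → mx ≡ just x × my ≡ just y × InZp p x × InZp p y
    × (ℤ.+ p) ℤD.∣ ↥ (x ℚ.- y)

module Submission where

-- Reduction modulo p is a ring homomorphism from ℤ_(p) onto ℤ/p, and a quotient stays in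
-- ℤ_(p) as soon as its denominator reduces to a unit.  So it suffices to follow residues:
-- with u ≡ 0, v ≡ δ and δ² + δ + 1 ≡ 0 (hence δ³ ≡ 1 and δ⁻¹ ≡ δ²), strong induction on
-- the index shows α_i ≡ 0 and β_i ≡ b_i, where b_1 = 1, b_2 = -δ, b_3 = δ and
--   b_{3k+4} = ρ(k),  b_{3k+5} = -δ - ρ(k),  b_{3k+6} = δ,
--   ρ(3m) = δ²,  ρ(3m+1) = 1,  ρ(3m+2) = ρ(m).
-- The denominators met on the way, β_{3k+5} ≡ -δ - ρ(k) and β_{3k+3}β_{3k+2}, are units
-- because -δ - δ² ≡ 1 and -δ - 1 ≡ δ².  The one genuine computation is that
-- β_{3k+4} = β_{k+2} / (β_{3k+3} β_{3k+2}) reproduces ρ(k), by cases on k mod 3.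

open import Data.Integer using (ℤ)
open import Data.Nat using (ℕ)
open import Data.Nat.Primality using (Prime)

module Reduction (p : ℕ) (p-prime : Prime p) where

  open import Data.Empty using (⊥)
  open import Data.Integer as ℤ using (+_; -_; +[1+_]; -[1+_]; _+_; _*_; _-_)
  import Data.Integer.Properties as ℤ
  open import Data.Integer.Divisibility.Signed
    using (_∣_; divides; ∣ᵤ⇒∣; ∣⇒∣ᵤ; ∣m∣n⇒∣m+n; ∣n⇒∣m*n)
  open import Data.Integer.Tactic.RingSolver using (solve-∀)
  open import Data.Maybe using (Maybe; just)
  open import Data.Nat as ℕ using (suc)
  open import Data.Nat.Coprimality using (coprime?)
  import Data.Nat.Divisibility as ℕ
  open import Data.Nat.Primality using (euclidsLemma; ¬prime[1])
  open import Data.Product using (_,_)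
  open import Data.Rational as ℚ using (ℚ; mkℚ; ↥_; 0ℚ; toℚᵘ)
  open import Data.Rational.Properties
    using (toℚᵘ-fromℚᵘ; toℚᵘ-homo-+; toℚᵘ-homo-*; toℚᵘ-homo‿-; toℚᵘ-homo-1/; _≟_)
  open import Data.Rational.Unnormalised as ℚᵘ using (ℚᵘ; mkℚᵘ; *≡*)
  open import Data.Sum using ([_,_]′)
  open import Relation.Binary.Bundles using (Setoid)
  open import Relation.Binary.PropositionalEquality using (_≡_; refl; sym; subst)
  open import Relation.Nullary using (¬_; yes; no; contradiction)
  open import Relation.Nullary.Decidable using (recompute)
  open import Defs using (InZp; ι; _+?_; _-?_; _*?_; _/?_; _≡_[mod_])

  infix 4 _≈_ _↦ᵘ_ _↦_

  record _≈_ (a b : ℤ) : Set where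
    constructor mod-p
    field p∣a-b : + p ∣ (a - b)

  private
    via : ∀ {x y} → x ≡ y → + p ∣ x → + p ∣ y
    via = subst (+ p ∣_)

  ≈-reflexive : ∀ {a b} → a ≡ b → a ≈ b
  ≈-reflexive {a} refl = mod-p (via (sym (ℤ.+-inverseʳ a)) (divides (+ 0) refl))

  ≈-refl : ∀ {a} → a ≈ a
  ≈-refl = ≈-reflexive refl

  ≈-sym : ∀ {a b} → a ≈ b → b ≈ a
  ≈-sym {a} {b} (mod-p h) = mod-p (via (identity a b) (∣n⇒∣m*n (- + 1) h))
    where
    identity : ∀ a b → - + 1 * (a - b) ≡ b - a
    identity = solve-∀

  ≈-trans : ∀ {a b c} → a ≈ b → b ≈ c → a ≈ c
  ≈-trans {a} {b} {c} (mod-p h) (mod-p h′) = mod-p (via (identity a b c) (∣m∣n⇒∣m+n h h′))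
    where
    identity : ∀ a b c → (a - b) + (b - c) ≡ a - c
    identity = solve-∀

  ≈-setoid : Setoid _ _
  ≈-setoid = record
    { Carrier = ℤ ; _≈_ = _≈_
    ; isEquivalence = record { refl = ≈-refl ; sym = ≈-sym ; trans = ≈-trans } }

  open import Relation.Binary.Reasoning.Setoid ≈-setoid

  ≈-+ : ∀ {a b c d} → a ≈ b → c ≈ d → a + c ≈ b + d
  ≈-+ {a} {b} {c} {d} (mod-p h) (mod-p h′) = mod-p (via (identity a b c d) (∣m∣n⇒∣m+n h h′))
    where
    identity : ∀ a b c d → (a - b) + (c - d) ≡ (a + c) - (b + d)
    identity = solve-∀

  ≈-neg : ∀ {a b} → a ≈ b → - a ≈ - b
  ≈-neg {a} {b} (mod-p h) = mod-p (via (identity a b) (∣n⇒∣m*n (- + 1) h))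
    where
    identity : ∀ a b → - + 1 * (a - b) ≡ (- a) - (- b)
    identity = solve-∀

  ≈-* : ∀ {a b c d} → a ≈ b → c ≈ d → a * c ≈ b * d
  ≈-* {a} {b} {c} {d} (mod-p h) (mod-p h′) =
    mod-p (via (identity a b c d) (∣m∣n⇒∣m+n (∣n⇒∣m*n c h) (∣n⇒∣m*n b h′)))
    where
    identity : ∀ a b c d → c * (a - b) + b * (c - d) ≡ a * c - b * d
    identity = solve-∀

  ≈0⇒∣ : ∀ {a} → a ≈ + 0 → + p ∣ a
  ≈0⇒∣ {a} (mod-p h) = via (ℤ.+-identityʳ a) h

  ∣⇒≈0 : ∀ {a} → + p ∣ a → a ≈ + 0
  ∣⇒≈0 {a} h = mod-p (via (sym (ℤ.+-identityʳ a)) h)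

  p∤1 : ¬ p ℕ.∣ 1
  p∤1 p∣1 = ¬prime[1] (subst Prime (ℕ.∣1⇒≡1 p∣1) p-prime)

  ∤-* : ∀ {m n} → ¬ p ℕ.∣ m → ¬ p ℕ.∣ n → ¬ p ℕ.∣ m ℕ.* n
  ∤-* {m} {n} p∤m p∤n p∣mn = [ p∤m , p∤n ]′ (euclidsLemma m n p-prime p∣mn)

  ≈-cancelʳ : ∀ {a b} n → a * + n ≈ b * + n → ¬ p ℕ.∣ n → a ≈ b
  ≈-cancelʳ {a} {b} n (mod-p h) p∤n =
    [ (λ p∣a-b → mod-p (∣ᵤ⇒∣ p∣a-b)) , (λ p∣n → contradiction p∣n p∤n) ]′
      (euclidsLemma ℤ.∣ a - b ∣ n p-prime p∣∣a-b∣n)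
    where
    identity : ∀ a b c → a * c - b * c ≡ (a - b) * c
    identity = solve-∀
    p∣∣a-b∣n : p ℕ.∣ ℤ.∣ a - b ∣ ℕ.* n
    p∣∣a-b∣n = subst (p ℕ.∣_) (ℤ.abs-* (a - b) (+ n)) (∣⇒∣ᵤ (via (identity a b (+ n)) h))

  ≈0-not-unit : ∀ {s t} → s ≈ + 0 → s * t ≈ + 1 → ⊥
  ≈0-not-unit {s} {t} s≈0 st≈1 =
    p∤1 (∣⇒∣ᵤ (≈0⇒∣ (≈-trans (≈-sym st≈1) (≈-* s≈0 (≈-refl {t})))))

  record _↦ᵘ_ (q : ℚᵘ) (r : ℤ) : Set where
    constructor mk↦ᵘ
    field
      p∤↧ : ¬ p ℕ.∣ ℚᵘ.↧ₙ q
      ↥≈r↧ : ℚᵘ.↥ q ≈ r * ℚᵘ.↧ q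

  ↦ᵘ-integer : ∀ z → mkℚᵘ z 0 ↦ᵘ z
  ↦ᵘ-integer z = mk↦ᵘ p∤1 (≈-reflexive (sym (ℤ.*-identityʳ z)))

  ↦ᵘ-+ : ∀ {q q′ r s} → q ↦ᵘ r → q′ ↦ᵘ s → q ℚᵘ.+ q′ ↦ᵘ r + s
  ↦ᵘ-+ {mkℚᵘ a d} {mkℚᵘ b e} {r} {s} (mk↦ᵘ p∤D a≈rD) (mk↦ᵘ p∤E b≈sE) =
    mk↦ᵘ (∤-* p∤D p∤E) (begin
      a * E + b * D          ≈⟨ ≈-+ (≈-* a≈rD (≈-refl {E})) (≈-* b≈sE (≈-refl {D})) ⟩
      r * D * E + s * E * D  ≡⟨ identity r s D E ⟩
      (r + s) * (D * E)      ∎)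
    where
    D E : ℤ
    D = + suc d
    E = + suc e
    identity : ∀ r s D E → r * D * E + s * E * D ≡ (r + s) * (D * E)
    identity = solve-∀

  ↦ᵘ-* : ∀ {q q′ r s} → q ↦ᵘ r → q′ ↦ᵘ s → q ℚᵘ.* q′ ↦ᵘ r * s
  ↦ᵘ-* {mkℚᵘ a d} {mkℚᵘ b e} {r} {s} (mk↦ᵘ p∤D a≈rD) (mk↦ᵘ p∤E b≈sE) =
    mk↦ᵘ (∤-* p∤D p∤E) (begin
      a * b            ≈⟨ ≈-* a≈rD b≈sE ⟩
      r * D * (s * E)  ≡⟨ identity r s D E ⟩
      r * s * (D * E)  ∎)
    where
    D E : ℤ
    D = + suc d
    E = + suc e
    identity : ∀ r s D E → r * D * (s * E) ≡ r * s * (D * E)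
    identity = solve-∀

  ↦ᵘ-neg : ∀ {q r} → q ↦ᵘ r → ℚᵘ.- q ↦ᵘ - r
  ↦ᵘ-neg {mkℚᵘ a d} {r} (mk↦ᵘ p∤D a≈rD) =
    mk↦ᵘ p∤D (≈-trans (≈-neg a≈rD) (≈-reflexive (ℤ.neg-distribˡ-* r (+ suc d))))

  private
    inverse-residue : ∀ {N D s t} → N ≈ s * D → s * t ≈ + 1 → D ≈ t * N
    inverse-residue {N} {D} {s} {t} N≈sD st≈1 = begin
      D            ≡⟨ sym (ℤ.*-identityˡ D) ⟩
      + 1 * D      ≈⟨ ≈-* (≈-sym st≈1) (≈-refl {D}) ⟩
      s * t * D    ≡⟨ identity s t D ⟩
      t * (s * D)  ≈⟨ ≈-* (≈-refl {t}) (≈-sym N≈sD) ⟩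
      t * N        ∎
      where
      identity : ∀ s t D → s * t * D ≡ t * (s * D)
      identity = solve-∀

    numerator-coprime : ∀ {N s t} d → ¬ p ℕ.∣ suc d → N ≈ s * + suc d → s * t ≈ + 1
                      → ¬ p ℕ.∣ ℤ.∣ N ∣
    numerator-coprime {N} {s} d p∤D N≈sD st≈1 p∣N = ≈0-not-unit s≈0 st≈1
      where
      s≈0 : s ≈ + 0
      s≈0 = ≈-cancelʳ (suc d) (≈-trans (≈-sym N≈sD) (∣⇒≈0 (∣ᵤ⇒∣ {+ p} {N} p∣N))) p∤D

  ↦ᵘ-1/ : ∀ {q s t} .{{_ : ℚᵘ.NonZero q}} → q ↦ᵘ s → s * t ≈ + 1 → ℚᵘ.1/ q ↦ᵘ t
  ↦ᵘ-1/ {mkℚᵘ +[1+ n ] d} {s} {t} (mk↦ᵘ p∤D N≈sD) st≈1 =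
    mk↦ᵘ (numerator-coprime {s = s} {t} d p∤D N≈sD st≈1) (inverse-residue {s = s} N≈sD st≈1)
  ↦ᵘ-1/ {mkℚᵘ -[1+ n ] d} {s} {t} (mk↦ᵘ p∤D N≈sD) st≈1 =
    mk↦ᵘ (numerator-coprime {s = s} {t} d p∤D N≈sD st≈1)
      (≈-trans (≈-neg (inverse-residue {s = s} N≈sD st≈1)) (≈-reflexive (ℤ.neg-distribʳ-* t -[1+ n ])))

  -- Normalisation only removes common factors; a factor p of the new denominator would also
  -- divide the numerator, against coprimality.
  ↦ᵘ-normalise : ∀ x {q r} → toℚᵘ x ℚᵘ.≃ q → q ↦ᵘ r → toℚᵘ x ↦ᵘ r
  ↦ᵘ-normalise (mkℚ a d coprime) {mkℚᵘ b e} {r} (*≡* aQ≡bD) (mk↦ᵘ p∤Q b≈rQ) = mk↦ᵘ p∤D a≈rD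
    where
    D Q : ℤ
    D = + suc d
    Q = + suc e
    identity : ∀ r D Q → r * Q * D ≡ r * D * Q
    identity = solve-∀
    a≈rD : a ≈ r * D
    a≈rD = ≈-cancelʳ (suc e) (begin
      a * Q      ≡⟨ aQ≡bD ⟩
      b * D      ≈⟨ ≈-* b≈rQ (≈-refl {D}) ⟩
      r * Q * D  ≡⟨ identity r D Q ⟩
      r * D * Q  ∎) p∤Q
    p∤D : ¬ p ℕ.∣ suc d
    p∤D p∣D = ¬prime[1] (subst Prime (recompute (coprime? ℤ.∣ a ∣ (suc d)) coprime (p∣a , p∣D)) p-prime)
      where
      a≈0 : a ≈ + 0
      a≈0 = ≈-cancelʳ (suc e) (begin
        a * Q    ≡⟨ aQ≡bD ⟩
        b * D    ≈⟨ ≈-* (≈-refl {b}) (∣⇒≈0 (∣ᵤ⇒∣ {+ p} {D} p∣D)) ⟩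
        b * + 0  ≡⟨ ℤ.*-zeroʳ b ⟩
        + 0      ≡⟨ sym (ℤ.*-zeroˡ Q) ⟩
        + 0 * Q  ∎) p∤Q
      p∣a : p ℕ.∣ ℤ.∣ a ∣
      p∣a = ∣⇒∣ᵤ (≈0⇒∣ a≈0)

  ↦ᵘ-resp-≈ : ∀ {q r s} → q ↦ᵘ r → r ≈ s → q ↦ᵘ s
  ↦ᵘ-resp-≈ {mkℚᵘ a d} (mk↦ᵘ p∤D a≈rD) r≈s = mk↦ᵘ p∤D (≈-trans a≈rD (≈-* r≈s (≈-refl {+ suc d})))

  record _↦_ (mx : Maybe ℚ) (r : ℤ) : Set where
    constructor mk↦
    field
      value : ℚ
      defined : mx ≡ just value
      reduces : toℚᵘ value ↦ᵘ r

  ι↦ : ∀ z → ι z ↦ z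
  ι↦ z = mk↦ (z ℚ./ 1) refl (↦ᵘ-normalise (z ℚ./ 1) (toℚᵘ-fromℚᵘ (mkℚᵘ z 0)) (↦ᵘ-integer z))

  ↦-resp-≈ : ∀ {mx r s} → mx ↦ r → r ≈ s → mx ↦ s
  ↦-resp-≈ (mk↦ x mx≡x x↦r) r≈s = mk↦ x mx≡x (↦ᵘ-resp-≈ x↦r r≈s)

  ↦-+ : ∀ {mx my r s} → mx ↦ r → my ↦ s → mx +? my ↦ r + s
  ↦-+ (mk↦ x refl x↦r) (mk↦ y refl y↦s) =
    mk↦ (x ℚ.+ y) refl (↦ᵘ-normalise (x ℚ.+ y) (toℚᵘ-homo-+ x y) (↦ᵘ-+ x↦r y↦s))

  ↦-sub : ∀ {mx my r s} → mx ↦ r → my ↦ s → mx -? my ↦ r - s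
  ↦-sub (mk↦ x refl x↦r) (mk↦ y refl y↦s) =
    mk↦ (x ℚ.- y) refl (↦ᵘ-normalise (x ℚ.- y) (toℚᵘ-homo-+ x (ℚ.- y))
      (↦ᵘ-+ x↦r (↦ᵘ-normalise (ℚ.- y) (toℚᵘ-homo‿- y) (↦ᵘ-neg y↦s))))

  ↦-* : ∀ {mx my r s} → mx ↦ r → my ↦ s → mx *? my ↦ r * s
  ↦-* (mk↦ x refl x↦r) (mk↦ y refl y↦s) =
    mk↦ (x ℚ.* y) refl (↦ᵘ-normalise (x ℚ.* y) (toℚᵘ-homo-* x y) (↦ᵘ-* x↦r y↦s))

  ↦-/ : ∀ {mx my r s t} → mx ↦ r → my ↦ s → s * t ≈ + 1 → mx /? my ↦ r * t
  ↦-/ {s = s} (mk↦ x refl x↦r) (mk↦ y refl y↦s) st≈1 with y ≟ 0ℚ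
  ... | yes refl =
    contradiction st≈1 (≈0-not-unit (≈-sym (≈-trans (_↦ᵘ_.↥≈r↧ y↦s) (≈-reflexive (ℤ.*-identityʳ s)))))
  ... | no y≢0 = mk↦ (x ℚ.÷ y) refl (↦ᵘ-normalise (x ℚ.÷ y) (toℚᵘ-homo-* x (ℚ.1/ y))
      (↦ᵘ-* x↦r (↦ᵘ-normalise (ℚ.1/ y) (toℚᵘ-homo-1/ y) (↦ᵘ-1/ y↦s st≈1))))
    where instance _ = ℚ.≢-nonZero y≢0

  private
    p∤↧ : ∀ x {r} → toℚᵘ x ↦ᵘ r → InZp p x
    p∤↧ (mkℚ _ _ _) = _↦ᵘ_.p∤↧

    ↦0⇒p∣↥ : ∀ x → toℚᵘ x ↦ᵘ + 0 → + p ∣ ↥ x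
    ↦0⇒p∣↥ (mkℚ a d _) (mk↦ᵘ _ a≈0D) = ≈0⇒∣ (≈-trans a≈0D (≈-reflexive (ℤ.*-zeroˡ (+ suc d))))

  ↦⇒≡[mod] : ∀ {mx my r s} → mx ↦ r → my ↦ s → r ≈ s → mx ≡ my [mod p ]
  ↦⇒≡[mod] {r = r} {s} mx↦r@(mk↦ x refl x↦r) my↦s@(mk↦ y refl y↦s) r≈s =
    x , y , refl , refl , p∤↧ x x↦r , p∤↧ y y↦s , ∣⇒∣ᵤ (↦0⇒p∣↥ (x ℚ.- y) x-y↦0)
    where
    r-s≈0 : r - s ≈ + 0
    r-s≈0 = ≈-trans (≈-+ r≈s (≈-refl { - s})) (≈-reflexive (ℤ.+-inverseʳ s))
    x-y↦0 : toℚᵘ (x ℚ.- y) ↦ᵘ + 0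
    x-y↦0 = _↦_.reduces (↦-resp-≈ (↦-sub mx↦r my↦s) r-s≈0)

module Indices where

  open import Data.Nat using (zero; suc; _+_; _*_; _<_; _≤_)
  open import Data.Nat.Divisibility using (divides)
  open import Data.Nat.DivMod
    using (_/_; _%_; m/n*n≤m; [m+kn]%n≡m%n; m<n⇒m%n≡m; m<n⇒m/n≡0; m*n/n≡m; +-distrib-/-∣ʳ)
  import Data.Nat.Properties as ℕ
  open import Relation.Binary.PropositionalEquality using (_≡_; refl; trans; cong; cong₂; subst)

  data Ternary : ℕ → Set where
    [m*3]   : ∀ m → Ternary (m * 3)
    [1+m*3] : ∀ m → Ternary (1 + m * 3)
    [2+m*3] : ∀ m → Ternary (2 + m * 3)

  ternary : ∀ n → Ternary n
  ternary zero = [m*3] 0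
  ternary (suc n) with ternary n
  ... | [m*3] m   = [1+m*3] m
  ... | [1+m*3] m = [2+m*3] m
  ... | [2+m*3] m = [m*3] (suc m)

  [r+k*3]%3≡r : ∀ r k → r < 3 → (r + k * 3) % 3 ≡ r
  [r+k*3]%3≡r r k r<3 = trans ([m+kn]%n≡m%n r k 3) (m<n⇒m%n≡m r<3)

  [r+k*3]/3≡k : ∀ r k → r < 3 → (r + k * 3) / 3 ≡ k
  [r+k*3]/3≡k r k r<3 =
    trans (+-distrib-/-∣ʳ r (divides k refl)) (cong₂ _+_ (m<n⇒m/n≡0 r<3) (m*n/n≡m k 3))

  3k+i≡i+k*3 : ∀ i k → 3 * k + i ≡ i + k * 3
  3k+i≡i+k*3 i k = trans (ℕ.+-comm (3 * k) i) (cong (_+_ i) (ℕ.*-comm 3 k))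

  3[j/3]+3≤3+j : ∀ j → 3 * (j / 3) + 3 ≤ 3 + j
  3[j/3]+3≤3+j j = subst (3 * (j / 3) + 3 ≤_) (ℕ.+-comm j 3)
    (ℕ.+-monoˡ-≤ 3 (subst (_≤ j) (ℕ.*-comm (j / 3) 3) (m/n*n≤m j 3)))

  k+2≤3k+3 : ∀ k → k + 2 ≤ 3 * k + 3
  k+2≤3k+3 k = ℕ.+-mono-≤ (ℕ.m≤n*m k 3) (ℕ.n≤1+n 2)

  3k+2≤3k+3 : ∀ k → 3 * k + 2 ≤ 3 * k + 3
  3k+2≤3k+3 k = ℕ.+-monoʳ-≤ (3 * k) (ℕ.n≤1+n 2)

-- `recurrence F k r` restates the local definitions of `seqAux`: reading (α_i, β_i) off the
-- table F, it computes (α_{3k+4+r}, β_{3k+4+r}).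
module Unfolding (u v : ℤ) where

  open import Data.Integer using (-_)
  open import Data.Maybe using (Maybe; nothing)
  open import Data.Nat using (zero; suc; _+_; _*_; _≤_; s≤s)
  open import Data.Nat.DivMod using (_/_; _%_)
  import Data.Nat.Properties as ℕ
  open import Data.Product using (_×_; _,_; proj₁; proj₂)
  open import Data.Rational using (ℚ)
  open import Relation.Binary.PropositionalEquality using (_≡_; refl; sym; trans; cong; cong₂)
  open import Defs using (seqAux; ι; _+?_; _-?_; _*?_; _/?_)
  open Indices using (3[j/3]+3≤3+j; k+2≤3k+3; 3k+2≤3k+3)

  β[3k+4] β[3k+5] α[3k+5] α[3k+6] β[3k+6] : (ℕ → Maybe ℚ × Maybe ℚ) → ℕ → Maybe ℚ
  β[3k+4] F k = proj₂ (F (k + 2)) /? (proj₂ (F (3 * k + 3)) *? proj₂ (F (3 * k + 2)))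
  β[3k+5] F k = ι u *? ι u -? ι v -? β[3k+4] F k
  α[3k+5] F k = ι u -? (proj₁ (F (k + 2)) +? ι u *? ι v -? proj₁ (F (3 * k + 2)) *? β[3k+4] F k)
                       /? β[3k+5] F k
  α[3k+6] F k = ι u -? α[3k+5] F k
  β[3k+6] F k = ι v -? α[3k+5] F k *? α[3k+6] F k

  recurrence : (ℕ → Maybe ℚ × Maybe ℚ) → ℕ → ℕ → Maybe ℚ × Maybe ℚ
  recurrence F k 0 = ι (- u) , β[3k+4] F k
  recurrence F k 1 = α[3k+5] F k , β[3k+5] F k
  recurrence F k 2 = α[3k+6] F k , β[3k+6] F k
  recurrence F k _ = nothing , nothing
  seqAux-suc : ∀ f j → seqAux u v (suc f) (4 + j) ≡ recurrence (seqAux u v f) (j / 3) (j % 3)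
  seqAux-suc f j with j % 3
  ... | 0 = refl
  ... | 1 = refl
  ... | 2 = refl
  ... | suc (suc (suc _)) = refl

  recurrence-local : ∀ F G k r → (∀ {m} → m ≤ 3 * k + 3 → F m ≡ G m)
                   → recurrence F k r ≡ recurrence G k r
  recurrence-local F G k r F≗G = go r
    where
    β4 : β[3k+4] F k ≡ β[3k+4] G k
    β4 = cong₂ _/?_ (cong proj₂ (F≗G (k+2≤3k+3 k)))
                    (cong₂ _*?_ (cong proj₂ (F≗G ℕ.≤-refl)) (cong proj₂ (F≗G (3k+2≤3k+3 k))))
    β5 : β[3k+5] F k ≡ β[3k+5] G k
    β5 = cong (ι u *? ι u -? ι v -?_) β4
    α5 : α[3k+5] F k ≡ α[3k+5] G k
    α5 = cong₂ (λ n d → ι u -? n /? d)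
           (cong₂ (λ a b → a +? ι u *? ι v -? b)
             (cong proj₁ (F≗G (k+2≤3k+3 k))) (cong₂ _*?_ (cong proj₁ (F≗G (3k+2≤3k+3 k))) β4))
           β5
    go : ∀ r → recurrence F k r ≡ recurrence G k r
    go 0 = cong (ι (- u) ,_) β4
    go 1 = cong₂ _,_ α5 β5
    go 2 = cong₂ _,_ (cong (ι u -?_) α5) (cong₂ (λ a b → ι v -? a *? b) α5 (cong (ι u -?_) α5))
    go (suc (suc (suc _))) = refl

  seqAux-fuel : ∀ f g i → i ≤ f → i ≤ g → seqAux u v f i ≡ seqAux u v g i
  seqAux-fuel zero    zero    zero _ _ = refl
  seqAux-fuel zero    (suc g) zero _ _ = refl
  seqAux-fuel (suc f) zero    zero _ _ = refl
  seqAux-fuel (suc f) (suc g) zero _ _ = refl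
  seqAux-fuel (suc f) (suc g) 1 _ _ = refl
  seqAux-fuel (suc f) (suc g) 2 _ _ = refl
  seqAux-fuel (suc f) (suc g) 3 _ _ = refl
  seqAux-fuel (suc f) (suc g) (suc (suc (suc (suc j)))) (s≤s 3+j≤f) (s≤s 3+j≤g) =
    trans (seqAux-suc f j) (trans (recurrence-local _ _ (j / 3) (j % 3) agree) (sym (seqAux-suc g j)))
    where
    agree : ∀ {m} → m ≤ 3 * (j / 3) + 3 → seqAux u v f m ≡ seqAux u v g m
    agree {m} m≤ = seqAux-fuel f g m (ℕ.≤-trans m≤ (ℕ.≤-trans (3[j/3]+3≤3+j j) 3+j≤f))
                                     (ℕ.≤-trans m≤ (ℕ.≤-trans (3[j/3]+3≤3+j j) 3+j≤g))

  αβ : ℕ → Maybe ℚ × Maybe ℚ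
  αβ i = seqAux u v i i

  αβ-recurrence : ∀ j → αβ (4 + j) ≡ recurrence αβ (j / 3) (j % 3)
  αβ-recurrence j = trans (seqAux-suc (3 + j) j) (recurrence-local _ _ (j / 3) (j % 3) agree)
    where
    agree : ∀ {m} → m ≤ 3 * (j / 3) + 3 → seqAux u v (3 + j) m ≡ αβ m
    agree {m} m≤ = seqAux-fuel (3 + j) m m (ℕ.≤-trans m≤ (3[j/3]+3≤3+j j)) ℕ.≤-refl

-- ρ k is the residue of β_{3k+4}, computed with fuel since the recursion goes from k to k / 3.
-- δ² plays the role of δ⁻¹, so that all residues are polynomials in δ.
module Residues (δ : ℤ) where

  open import Data.Integer as ℤ using (+_; -_)
  open import Data.Nat using (zero; suc; _+_; _*_; _<_; z≤n; s≤s)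
  open import Data.Nat.DivMod using (_/_; _%_; m/n<m; m*n%n≡0)
  import Data.Nat.Properties as ℕ
  open import Data.Sum using (_⊎_; inj₁; inj₂)
  open import Relation.Binary.PropositionalEquality using (_≡_; refl; cong; cong₂; module ≡-Reasoning)
  open Indices using ([r+k*3]%3≡r; [r+k*3]/3≡k)

  digit : ℕ → ℤ → ℤ
  digit 0 _ = δ ℤ.* δ
  digit 1 _ = + 1
  digit _ r = r

  ρ-fuel : ℕ → ℕ → ℤ
  ρ-fuel zero    _ = δ ℤ.* δ
  ρ-fuel (suc f) k = digit (k % 3) (ρ-fuel f (k / 3))

  ρ : ℕ → ℤ
  ρ k = ρ-fuel (suc k) k

  ρ-fuel-irrelevant : ∀ f g k → k < f → k < g → ρ-fuel f k ≡ ρ-fuel g k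
  ρ-fuel-irrelevant (suc f) (suc g) zero      _         _         = refl
  ρ-fuel-irrelevant (suc f) (suc g) k@(suc _) (s≤s k≤f) (s≤s k≤g) =
    cong (digit (k % 3)) (ρ-fuel-irrelevant f g (k / 3) (ℕ.<-≤-trans k/3<k k≤f) (ℕ.<-≤-trans k/3<k k≤g))
    where
    k/3<k : k / 3 < k
    k/3<k = m/n<m k 3 (s≤s (s≤s z≤n))

  ρ[m*3]≡δ² : ∀ m → ρ (m * 3) ≡ δ ℤ.* δ
  ρ[m*3]≡δ² m = cong (λ r → digit r (ρ-fuel (m * 3) (m * 3 / 3))) (m*n%n≡0 m 3)

  ρ[1+m*3]≡1 : ∀ m → ρ (1 + m * 3) ≡ + 1
  ρ[1+m*3]≡1 m =
    cong (λ r → digit r (ρ-fuel (1 + m * 3) ((1 + m * 3) / 3))) ([r+k*3]%3≡r 1 m (s≤s (s≤s z≤n)))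

  ρ[2+m*3]≡ρ[m] : ∀ m → ρ (2 + m * 3) ≡ ρ m
  ρ[2+m*3]≡ρ[m] m = begin
    digit ((2 + m * 3) % 3) (ρ-fuel (2 + m * 3) ((2 + m * 3) / 3))
      ≡⟨ cong₂ digit ([r+k*3]%3≡r 2 m 2<3) (cong (ρ-fuel (2 + m * 3)) ([r+k*3]/3≡k 2 m 2<3)) ⟩
    ρ-fuel (2 + m * 3) m
      ≡⟨ ρ-fuel-irrelevant (2 + m * 3) (suc m) m (s≤s (ℕ.m≤n⇒m≤1+n (ℕ.m≤m*n m 3))) ℕ.≤-refl ⟩
    ρ m ∎
    where
    open ≡-Reasoning
    2<3 : 2 < 3
    2<3 = s≤s (s≤s (s≤s z≤n))

  ρ-values : ∀ k → ρ k ≡ δ ℤ.* δ ⊎ ρ k ≡ + 1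
  ρ-values k = fuel-values (suc k) k
    where
    digit-values : ∀ r {x} → x ≡ δ ℤ.* δ ⊎ x ≡ + 1 → digit r x ≡ δ ℤ.* δ ⊎ digit r x ≡ + 1
    digit-values 0             _        = inj₁ refl
    digit-values 1             _        = inj₂ refl
    digit-values (suc (suc _)) x-values = x-values
    fuel-values : ∀ f k → ρ-fuel f k ≡ δ ℤ.* δ ⊎ ρ-fuel f k ≡ + 1
    fuel-values zero    k = inj₁ refl
    fuel-values (suc f) k = digit-values (k % 3) (fuel-values f (k / 3))

  -- βResidue i is the residue of β_i; index 0, and blockResidue k r for r ≥ 3, never occur.
  blockResidue : ℕ → ℕ → ℤ
  blockResidue k 0 = ρ k
  blockResidue k 1 = - δ ℤ.- ρ k
  blockResidue k 2 = δ
  blockResidue k _ = + 0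

  βResidue : ℕ → ℤ
  βResidue 0 = + 0
  βResidue 1 = + 1
  βResidue 2 = - δ
  βResidue 3 = δ
  βResidue (suc (suc (suc (suc j)))) = blockResidue (j / 3) (j % 3)

  private
    βResidue-block : ∀ r k → r < 3 → βResidue (4 + (r + k * 3)) ≡ blockResidue k r
    βResidue-block r k r<3 = cong₂ blockResidue ([r+k*3]/3≡k r k r<3) ([r+k*3]%3≡r r k r<3)

  βResidue[3+k*3]≡δ : ∀ k → βResidue (3 + k * 3) ≡ δ
  βResidue[3+k*3]≡δ zero    = refl
  βResidue[3+k*3]≡δ (suc k) = βResidue-block 2 k (s≤s (s≤s (s≤s z≤n)))

  βResidue[4+k*3]≡ρ[k] : ∀ k → βResidue (4 + k * 3) ≡ ρ k
  βResidue[4+k*3]≡ρ[k] k = βResidue-block 0 k (s≤s z≤n)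

  βResidue[5+k*3]≡-δ-ρ[k] : ∀ k → βResidue (5 + k * 3) ≡ - δ ℤ.- ρ k
  βResidue[5+k*3]≡-δ-ρ[k] k = βResidue-block 1 k (s≤s (s≤s z≤n))

module Congruences (p : ℕ) (p-prime : Prime p) (δ δ⁻¹ u v : ℤ) where

  open import Data.Integer as ℤ using (+_; -_; _+_; _*_; _-_)
  import Data.Integer.Properties as ℤ
  open import Data.Integer.Divisibility.Signed using (_∣_; ∣n⇒∣m*n)
  open import Data.Integer.Tactic.RingSolver using (solve; solve-∀)
  open import Data.List using (_∷_; [])
  open import Data.Maybe using (Maybe)
  open import Data.Nat as ℕ using (zero; suc; z≤n; s≤s)
  open import Data.Nat.DivMod using (_/_; _%_; m%n<n)
  open import Data.Nat.Induction using (<-rec)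
  import Data.Nat.Properties as ℕₚ
  import Data.Nat.Tactic.RingSolver as ℕ-Solver
  open import Data.Product using (∃-syntax; _×_; _,_; proj₁; proj₂)
  open import Data.Rational using (ℚ)
  open import Data.Sum using (_⊎_; inj₁; inj₂)
  open import Relation.Binary.PropositionalEquality using (_≡_; refl; sym; cong; subst)
  open import Defs using (α; β; ι; _+?_; _*?_; _≡_[mod_])
  open Reduction p p-prime
  open Indices
  open Unfolding u v
  open Residues δ
  open import Relation.Binary.Reasoning.Setoid ≈-setoid

  module Assuming (Φ₃≈0 : δ * δ + δ + + 1 ≈ + 0) (δδ⁻¹≈1 : δ * δ⁻¹ ≈ + 1)
                  (u≈0 : u ≈ + 0) (v≈δ : v ≈ δ) where

    -- x is the quotient of a - b by Φ₃ = δ² + δ + 1 (found by polynomial division); the ring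
    -- solver checks the division.
    ≈-mod-Φ₃ : ∀ {a b} x → a - b ≡ x * (δ * δ + δ + + 1) → a ≈ b
    ≈-mod-Φ₃ x eq = mod-p (subst (+ p ∣_) (sym eq) (∣n⇒∣m*n x (≈0⇒∣ Φ₃≈0)))

    δ³≈1 : δ * δ * δ ≈ + 1
    δ³≈1 = ≈-mod-Φ₃ (δ - + 1) (solve (δ ∷ []))

    δ²≈δ⁻¹ : δ * δ ≈ δ⁻¹
    δ²≈δ⁻¹ = begin
      δ * δ                 ≡⟨ sym (ℤ.*-identityʳ (δ * δ)) ⟩
      δ * δ * + 1           ≈⟨ ≈-* (≈-refl {δ * δ}) (≈-sym δδ⁻¹≈1) ⟩
      δ * δ * (δ * δ⁻¹)     ≡⟨ identity δ δ⁻¹ ⟩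
      δ * δ * δ * δ⁻¹       ≈⟨ ≈-* δ³≈1 (≈-refl {δ⁻¹}) ⟩
      + 1 * δ⁻¹             ≡⟨ ℤ.*-identityˡ δ⁻¹ ⟩
      δ⁻¹                   ∎
      where
      identity : ∀ δ e → δ * δ * (δ * e) ≡ δ * δ * δ * e
      identity = solve-∀

    -δ-ρ-invertible : ∀ k → ∃[ t ] (- δ - ρ k) * t ≈ + 1
    -δ-ρ-invertible k = invertible (ρ-values k)
      where
      invertible : ∀ {c} → c ≡ δ * δ ⊎ c ≡ + 1 → ∃[ t ] (- δ - c) * t ≈ + 1
      invertible (inj₁ refl) = + 1 , ≈-mod-Φ₃ (- + 1) (solve (δ ∷ []))
      invertible (inj₂ refl) = δ , ≈-mod-Φ₃ (- + 1) (solve (δ ∷ []))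

    private
      δ·δ²≈1 : δ * (δ * δ) ≈ + 1
      δ·δ²≈1 = ≈-mod-Φ₃ (δ - + 1) (solve (δ ∷ []))

      δ·-δ·-δ≈1 : δ * - δ * - δ ≈ + 1
      δ·-δ·-δ≈1 = ≈-mod-Φ₃ (δ - + 1) (solve (δ ∷ []))

      δ[-δ-δ²]δ²≈1 : δ * (- δ - δ * δ) * (δ * δ) ≈ + 1
      δ[-δ-δ²]δ²≈1 = ≈-mod-Φ₃ (- δ * δ * δ + δ - + 1) (solve (δ ∷ []))

      δ[-δ-1]≈1 : δ * (- δ - + 1) * + 1 ≈ + 1
      δ[-δ-1]≈1 = ≈-mod-Φ₃ (- + 1) (solve (δ ∷ []))

    ρ[1+k]-quotient : ∀ {k} → Ternary k
      → ∃[ t ] δ * (- δ - ρ k) * t ≈ + 1 × βResidue (3 ℕ.+ k) * t ≈ ρ (suc k)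
    ρ[1+k]-quotient ([m*3] m) = δ * δ ,
      (begin
        δ * (- δ - ρ (m ℕ.* 3)) * (δ * δ)   ≡⟨ cong (λ c → δ * (- δ - c) * (δ * δ)) (ρ[m*3]≡δ² m) ⟩
        δ * (- δ - δ * δ) * (δ * δ)         ≈⟨ δ[-δ-δ²]δ²≈1 ⟩
        + 1                                 ∎) ,
      (begin
        βResidue (3 ℕ.+ m ℕ.* 3) * (δ * δ)  ≡⟨ cong (_* (δ * δ)) (βResidue[3+k*3]≡δ m) ⟩
        δ * (δ * δ)                         ≈⟨ δ·δ²≈1 ⟩
        + 1                                 ≡⟨ sym (ρ[1+m*3]≡1 m) ⟩
        ρ (1 ℕ.+ m ℕ.* 3)                   ∎)
    ρ[1+k]-quotient ([1+m*3] m) = + 1 ,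
      (begin
        δ * (- δ - ρ (1 ℕ.+ m ℕ.* 3)) * + 1  ≡⟨ cong (λ c → δ * (- δ - c) * + 1) (ρ[1+m*3]≡1 m) ⟩
        δ * (- δ - + 1) * + 1                ≈⟨ δ[-δ-1]≈1 ⟩
        + 1                                  ∎) ,
      (begin
        βResidue (4 ℕ.+ m ℕ.* 3) * + 1       ≡⟨ cong (_* + 1) (βResidue[4+k*3]≡ρ[k] m) ⟩
        ρ m * + 1                            ≡⟨ ℤ.*-identityʳ (ρ m) ⟩
        ρ m                                  ≡⟨ sym (ρ[2+m*3]≡ρ[m] m) ⟩
        ρ (2 ℕ.+ m ℕ.* 3)                    ∎)
    ρ[1+k]-quotient ([2+m*3] m) = t * (δ * δ) ,
      (begin
        δ * (- δ - ρ (2 ℕ.+ m ℕ.* 3)) * (t * (δ * δ))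
          ≡⟨ cong (λ c → δ * (- δ - c) * (t * (δ * δ))) (ρ[2+m*3]≡ρ[m] m) ⟩
        δ * a * (t * (δ * δ))  ≡⟨ identity δ a t ⟩
        a * t * (δ * δ * δ)    ≈⟨ ≈-* at≈1 δ³≈1 ⟩
        + 1                    ∎) ,
      (begin
        βResidue (5 ℕ.+ m ℕ.* 3) * (t * (δ * δ))
          ≡⟨ cong (_* (t * (δ * δ))) (βResidue[5+k*3]≡-δ-ρ[k] m) ⟩
        a * (t * (δ * δ))  ≡⟨ sym (ℤ.*-assoc a t (δ * δ)) ⟩
        a * t * (δ * δ)    ≈⟨ ≈-* at≈1 (≈-refl {δ * δ}) ⟩
        + 1 * (δ * δ)      ≡⟨ ℤ.*-identityˡ (δ * δ) ⟩
        δ * δ              ≡⟨ sym (ρ[m*3]≡δ² (suc m)) ⟩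
        ρ (suc m ℕ.* 3)    ∎)
      where
      a t : ℤ
      a = - δ - ρ m
      t = proj₁ (-δ-ρ-invertible m)
      at≈1 : a * t ≈ + 1
      at≈1 = proj₂ (-δ-ρ-invertible m)
      identity : ∀ δ a t → δ * a * (t * (δ * δ)) ≡ a * t * (δ * δ * δ)
      identity = solve-∀

    β[3k+4]-quotient : ∀ k
      → ∃[ t ] βResidue (3 ℕ.* k ℕ.+ 3) * βResidue (3 ℕ.* k ℕ.+ 2) * t ≈ + 1
             × βResidue (k ℕ.+ 2) * t ≈ ρ k
    β[3k+4]-quotient k
      rewrite 3k+i≡i+k*3 3 k | 3k+i≡i+k*3 2 k | ℕₚ.+-comm k 2 | βResidue[3+k*3]≡δ k = normal k
      where
      normal : ∀ k → ∃[ t ] δ * βResidue (2 ℕ.+ k ℕ.* 3) * t ≈ + 1 × βResidue (2 ℕ.+ k) * t ≈ ρ k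
      normal zero = - δ , δ·-δ·-δ≈1 , ≈-reflexive (identity δ)
        where
        identity : ∀ δ → - δ * - δ ≡ δ * δ
        identity = solve-∀
      normal (suc k) with ρ[1+k]-quotient (ternary k)
      ... | t , unit , residue =
        t , ≈-trans (≈-reflexive (cong (λ b → δ * b * t) (βResidue[5+k*3]≡-δ-ρ[k] k))) unit , residue

    u↦0 : ι u ↦ + 0
    u↦0 = ↦-resp-≈ (ι↦ u) u≈0

    -u↦0 : ι (- u) ↦ + 0
    -u↦0 = ↦-resp-≈ (ι↦ (- u)) (≈-neg u≈0)

    v↦δ : ι v ↦ δ
    v↦δ = ↦-resp-≈ (ι↦ v) v≈δ

    u²↦0 : ι u *? ι u ↦ + 0
    u²↦0 = ↦-* u↦0 u↦0

    Reduces : Maybe ℚ × Maybe ℚ → ℤ → Set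
    Reduces αβᵢ r = proj₁ αβᵢ ↦ + 0 × proj₂ αβᵢ ↦ r

    ResiduesAt : ℕ → Set
    ResiduesAt n = Reduces (αβ n) (βResidue n)

    residuesAt-1 : ResiduesAt 1
    residuesAt-1 = -u↦0 , ι↦ (+ 1)

    -- A residue with a left factor + 0 computes to + 0, which is why the α's need no ↦-resp-≈.
    residuesAt-2 : ResiduesAt 2
    residuesAt-2 =
      ↦-/ {t = δ * δ} (↦-* u↦0 (↦-sub (↦-sub (↦-* (ι↦ (+ 2)) v↦δ) (ι↦ (+ 1))) u²↦0)) (↦-sub v↦δ u²↦0)
          (≈-mod-Φ₃ (δ - + 1) (solve (δ ∷ [])))
      , ↦-resp-≈ (↦-sub u²↦0 v↦δ) (≈-reflexive (ℤ.+-identityˡ (- δ)))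

    residuesAt-3 : ResiduesAt 3
    residuesAt-3 =
      ↦-/ {t = δ * δ} (↦-* -u↦0 (↦-sub v↦δ (ι↦ (+ 1)))) (↦-sub v↦δ u²↦0)
          (≈-mod-Φ₃ (δ - + 1) (solve (δ ∷ [])))
      , ↦-resp-≈
          (↦-/ {t = δ}
            (↦-sub (↦-+ (↦-+ u²↦0 (↦-* (↦-* u²↦0 u↦0) u↦0)) (↦-* (↦-* v↦δ v↦δ) v↦δ))
                 (↦-* (↦-* (↦-* (ι↦ (+ 3)) u↦0) u↦0) v↦δ))
            (↦-* (↦-sub v↦δ u²↦0) (↦-sub v↦δ u²↦0))
            (≈-mod-Φ₃ (δ - + 1) (solve (δ ∷ []))))
          (≈-mod-Φ₃ {b = δ} (δ * δ - δ) (solve (δ ∷ [])))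

    private
      1≤n+[1+m] : ∀ n m → 1 ℕ.≤ n ℕ.+ suc m
      1≤n+[1+m] n m = ℕₚ.≤-trans (s≤s z≤n) (ℕₚ.m≤n+m (suc m) n)

    residuesAt-block : ∀ k r → r ℕ.< 3 → (∀ {m} → 1 ℕ.≤ m → m ℕ.≤ 3 ℕ.* k ℕ.+ 3 → ResiduesAt m)
                     → Reduces (recurrence αβ k r) (blockResidue k r)
    residuesAt-block k r r<3 earlier = at r r<3
      where
      residues[k+2] : ResiduesAt (k ℕ.+ 2)
      residues[k+2] = earlier (1≤n+[1+m] k 1) (k+2≤3k+3 k)
      residues[3k+2] : ResiduesAt (3 ℕ.* k ℕ.+ 2)
      residues[3k+2] = earlier (1≤n+[1+m] (3 ℕ.* k) 1) (3k+2≤3k+3 k)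
      residues[3k+3] : ResiduesAt (3 ℕ.* k ℕ.+ 3)
      residues[3k+3] = earlier (1≤n+[1+m] (3 ℕ.* k) 2) ℕₚ.≤-refl

      β₄ : β[3k+4] αβ k ↦ ρ k
      β₄ with β[3k+4]-quotient k
      ... | t , unit , residue = ↦-resp-≈
        (↦-/ {t = t} (proj₂ residues[k+2]) (↦-* (proj₂ residues[3k+3]) (proj₂ residues[3k+2])) unit)
        residue

      β₅ : β[3k+5] αβ k ↦ - δ - ρ k
      β₅ = ↦-resp-≈ (↦-sub (↦-sub u²↦0 v↦δ) β₄)
                    (≈-+ (≈-reflexive (ℤ.+-identityˡ (- δ))) (≈-refl { - ρ k }))

      α₅ : α[3k+5] αβ k ↦ + 0
      α₅ = ↦-sub u↦0 (↦-/ {t = proj₁ (-δ-ρ-invertible k)}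
             (↦-sub (↦-+ (proj₁ residues[k+2]) (↦-* u↦0 v↦δ)) (↦-* (proj₁ residues[3k+2]) β₄))
             β₅ (proj₂ (-δ-ρ-invertible k)))

      α₆ : α[3k+6] αβ k ↦ + 0
      α₆ = ↦-sub u↦0 α₅

      β₆ : β[3k+6] αβ k ↦ δ
      β₆ = ↦-resp-≈ (↦-sub v↦δ (↦-* α₅ α₆)) (≈-reflexive (ℤ.+-identityʳ δ))

      at : ∀ r → r ℕ.< 3 → Reduces (recurrence αβ k r) (blockResidue k r)
      at 0 _ = -u↦0 , β₄
      at 1 _ = α₅ , β₅
      at 2 _ = α₆ , β₆
      at (suc (suc (suc _))) (s≤s (s≤s (s≤s ())))

    residuesAt : ∀ n → 1 ℕ.≤ n → ResiduesAt n
    residuesAt = <-rec (λ n → 1 ℕ.≤ n → ResiduesAt n) step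
      where
      step : ∀ n → (∀ {m} → m ℕ.< n → 1 ℕ.≤ m → ResiduesAt m) → 1 ℕ.≤ n → ResiduesAt n
      step 1 _ _ = residuesAt-1
      step 2 _ _ = residuesAt-2
      step 3 _ _ = residuesAt-3
      step (suc (suc (suc (suc j)))) earlier _ =
        subst (λ αβᵢ → Reduces αβᵢ (βResidue (4 ℕ.+ j))) (sym (αβ-recurrence j))
          (residuesAt-block (j / 3) (j % 3) (m%n<n j 3)
            (λ 1≤m m≤ → earlier (s≤s (ℕₚ.≤-trans m≤ (3[j/3]+3≤3+j j))) 1≤m))

    β↦βResidue : ∀ n → 1 ℕ.≤ n → β u v n ↦ βResidue n
    β↦βResidue n 1≤n = proj₂ (residuesAt n 1≤n)

    β-reindex : ∀ {m n r} → m ≡ n → β u v n ↦ r → β u v m ↦ r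
    β-reindex {r = r} m≡n = subst (λ i → β u v i ↦ r) (sym m≡n)

    β[3k+3]↦δ : ∀ k → β u v (3 ℕ.* k ℕ.+ 3) ↦ δ
    β[3k+3]↦δ k = β-reindex (3k+i≡i+k*3 3 k)
      (↦-resp-≈ (β↦βResidue (3 ℕ.+ k ℕ.* 3) (s≤s z≤n)) (≈-reflexive (βResidue[3+k*3]≡δ k)))

    β[3k+4]↦ρ : ∀ k → β u v (3 ℕ.* k ℕ.+ 4) ↦ ρ k
    β[3k+4]↦ρ k = β-reindex (3k+i≡i+k*3 4 k)
      (↦-resp-≈ (β↦βResidue (4 ℕ.+ k ℕ.* 3) (s≤s z≤n)) (≈-reflexive (βResidue[4+k*3]≡ρ[k] k)))

    β[3k+5]↦-δ-ρ : ∀ k → β u v (3 ℕ.* k ℕ.+ 5) ↦ - δ - ρ k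
    β[3k+5]↦-δ-ρ k = β-reindex (3k+i≡i+k*3 5 k)
      (↦-resp-≈ (β↦βResidue (5 ℕ.+ k ℕ.* 3) (s≤s z≤n)) (≈-reflexive (βResidue[5+k*3]≡-δ-ρ[k] k)))

    α≡0 : ∀ i → α u v (suc i) ≡ ι (+ 0) [mod p ]
    α≡0 i = ↦⇒≡[mod] (proj₁ (residuesAt (suc i) (s≤s z≤n))) (ι↦ (+ 0)) ≈-refl

    β₁≡1 : β u v 1 ≡ ι (+ 1) [mod p ]
    β₁≡1 = ↦⇒≡[mod] (β↦βResidue 1 (s≤s z≤n)) (ι↦ (+ 1)) ≈-refl

    β₂≡-δ : β u v 2 ≡ ι (- δ) [mod p ]
    β₂≡-δ = ↦⇒≡[mod] (β↦βResidue 2 (s≤s z≤n)) (ι↦ (- δ)) ≈-refl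

    β[3k+3]≡δ : ∀ k → β u v (3 ℕ.* k ℕ.+ 3) ≡ ι δ [mod p ]
    β[3k+3]≡δ k = ↦⇒≡[mod] (β[3k+3]↦δ k) (ι↦ δ) ≈-refl

    β[3k+4]+β[3k+5]≡-δ : ∀ k → β u v (3 ℕ.* k ℕ.+ 4) +? β u v (3 ℕ.* k ℕ.+ 5) ≡ ι (- δ) [mod p ]
    β[3k+4]+β[3k+5]≡-δ k =
      ↦⇒≡[mod] (↦-+ (β[3k+4]↦ρ k) (β[3k+5]↦-δ-ρ k)) (ι↦ (- δ)) (≈-reflexive (identity δ (ρ k)))
      where
      identity : ∀ δ c → c + (- δ - c) ≡ - δ
      identity = solve-∀

    β[9k+1]≡β[3k+1] : ∀ k → β u v (9 ℕ.* k ℕ.+ 1) ≡ β u v (3 ℕ.* k ℕ.+ 1) [mod p ]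
    β[9k+1]≡β[3k+1] zero    = ↦⇒≡[mod] (β↦βResidue 1 (s≤s z≤n)) (β↦βResidue 1 (s≤s z≤n)) ≈-refl
    β[9k+1]≡β[3k+1] (suc k) =
      ↦⇒≡[mod] (β-reindex (index₉ k) (β[3k+4]↦ρ (2 ℕ.+ k ℕ.* 3))) (β-reindex (index₃ k) (β[3k+4]↦ρ k))
               (≈-reflexive (ρ[2+m*3]≡ρ[m] k))
      where
      index₉ : ∀ k → 9 ℕ.* suc k ℕ.+ 1 ≡ 3 ℕ.* (2 ℕ.+ k ℕ.* 3) ℕ.+ 4
      index₉ = ℕ-Solver.solve-∀
      index₃ : ∀ k → 3 ℕ.* suc k ℕ.+ 1 ≡ 3 ℕ.* k ℕ.+ 4
      index₃ = ℕ-Solver.solve-∀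

    β[9k+4]≡δ⁻¹ : ∀ k → β u v (9 ℕ.* k ℕ.+ 4) ≡ ι δ⁻¹ [mod p ]
    β[9k+4]≡δ⁻¹ k = ↦⇒≡[mod] (β-reindex (index k) (β[3k+4]↦ρ (k ℕ.* 3))) (ι↦ δ⁻¹)
      (≈-trans (≈-reflexive (ρ[m*3]≡δ² k)) δ²≈δ⁻¹)
      where
      index : ∀ k → 9 ℕ.* k ℕ.+ 4 ≡ 3 ℕ.* (k ℕ.* 3) ℕ.+ 4
      index = ℕ-Solver.solve-∀

    β[9k+7]≡1 : ∀ k → β u v (9 ℕ.* k ℕ.+ 7) ≡ ι (+ 1) [mod p ]
    β[9k+7]≡1 k = ↦⇒≡[mod] (β-reindex (index k) (β[3k+4]↦ρ (1 ℕ.+ k ℕ.* 3))) (ι↦ (+ 1))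
      (≈-reflexive (ρ[1+m*3]≡1 k))
      where
      index : ∀ k → 9 ℕ.* k ℕ.+ 7 ≡ 3 ℕ.* (1 ℕ.+ k ℕ.* 3) ℕ.+ 4
      index = ℕ-Solver.solve-∀

open import Defs
open import Data.Nat using (suc; _+_; _*_)
open import Data.Integer using (+_; -_)
open import Data.Integer.Divisibility using (_∣_)
open import Data.Integer.Divisibility.Signed using (∣ᵤ⇒∣)
open import Data.Product using (_×_; _,_)

lemma6 : (p : ℕ) → Prime p → (δ δinv u v : ℤ)
    → (+ p) ∣ (δ Data.Integer.* δ Data.Integer.+ δ Data.Integer.+ + 1)
    → (+ p) ∣ (δ Data.Integer.* δinv Data.Integer.- + 1)
    → (+ p) ∣ u
    → (+ p) ∣ (v Data.Integer.- δ)
    → ((i : ℕ) → α u v (suc i) ≡ ι (+ 0) [mod p ])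
    × (β u v 1 ≡ ι (+ 1) [mod p ])
    × (β u v 2 ≡ ι (- δ) [mod p ])
    × ((k : ℕ) →
    (β u v (3 * k + 3) ≡ ι δ [mod p ])
    × (β u v (3 * k + 4) +? β u v (3 * k + 5) ≡ ι (- δ) [mod p ])
    × (β u v (9 * k + 1) ≡ β u v (3 * k + 1) [mod p ])
    × (β u v (9 * k + 4) ≡ ι δinv [mod p ])
    × (β u v (9 * k + 7) ≡ ι (+ 1) [mod p ]))
lemma6 p p-prime δ δinv u v p∣Φ₃ p∣δδinv-1 p∣u p∣v-δ =
  α≡0 , β₁≡1 , β₂≡-δ ,
  λ k → β[3k+3]≡δ k , β[3k+4]+β[3k+5]≡-δ k , β[9k+1]≡β[3k+1] k , β[9k+4]≡δ⁻¹ k , β[9k+7]≡1 k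
  where
  open Reduction p p-prime using (mod-p; ∣⇒≈0)
  open Congruences p p-prime δ δinv u v
  open Assuming (∣⇒≈0 (∣ᵤ⇒∣ p∣Φ₃)) (mod-p (∣ᵤ⇒∣ p∣δδinv-1)) (∣⇒≈0 (∣ᵤ⇒∣ p∣u)) (mod-p (∣ᵤ⇒∣ p∣v-δ))
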